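{- Let $\zeta_1,\zeta_2\in wAC(P)$ and $\alpha,\beta\in\{0,1\}$. Then in $wAC(P)/\equiv$: (a) $\overline{\big[[\zeta_1]^{\alpha}\big]^{\beta}}=\overline{[\zeta_1]^{\beta}}$; (b) $\overline{[\zeta_1\oplus\zeta_2]^{\alpha}}=\overline{[\zeta_1]^{\alpha}}\oplus\overline{[\zeta_2]^{\alpha}}$; (c) $\overline{[\zeta_1]^{\alpha}}\oplus\overline{[\zeta_2]^{\beta}}=\overline{[\zeta_2]^{\beta}}\oplus\overline{[\zeta_1]^{\alpha}}$; (d) $\overline{[\zeta_1]^{\alpha}}\otimes\overline{[\zeta_2]^{\beta}}=\overline{[\zeta_2]^{\beta}}\otimes\overline{[\zeta_1]^{\alpha}}$.
   Context: $(K,\oplus,\otimes,\hat0,\hat1)$ is a commutative, additively idempotent semiring; $P$ is a finite nonempty set of ports with $0,1\notin P$ and weights $k_p\in K$. $wAI(P)$ is the weighted Algebra of Interactions: terms $z::=0\mid1\mid p\mid z\oplus z\mid z\otimes z\mid(z)$, with semantics $\|z\|(\gamma)\in K$ for $\gamma\in\Gamma(P)=2^{2^P}$: $\|0\|(\gamma)=\hat0$; $\|1\|(\gamma)=\hat1$ iff $\emptyset\in\gamma$ (else $\hat0$); $\|p\|(\gamma)=k_p$ if some $a\in\gamma$ contains $p$ (else $\hat0$); $\|z_1\oplus z_2\|(\gamma)=\bigoplus_{a\in\gamma}(\|z_1\|(\{a\})\oplus\|z_2\|(\{a\}))$; $\|z_1\otimes z_2\|(\gamma)=\bigoplus_{a\in\gamma}\bigoplus_{a_1\cup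 a_2=a}(\|z_1\|(\{a_1\})\otimes\|z_2\|(\{a_2\}))$ (inner sum over pairs of possibly empty subsets of $P$); $\|(z)\|=\|z\|$. On $wAI(P)$, $z_1\equiv z_2$ iff $\|z_1\|=\|z_2\|$ on all of $\Gamma(P)$; the quotient $wAI(P)/\equiv$ is a commutative idempotent semiring under $\oplus,\otimes$ with zero $\overline0$ and one $\overline1$, and computations with $wAI(P)$ terms are done in it. The weighted Algebra of Connectors $wAC(P)$ has syntax: synchrons $\sigma::=[0]\mid[1]\mid[p]\mid[\zeta]$, triggers $\tau::=[0]'\mid[1]'\mid[p]'\mid[\zeta]'$, and $\zeta::=\sigma\mid\tau\mid\zeta\oplus\zeta\mid\zeta\otimes\zeta$, where weighted fusion $\otimes$ is applied to typed connectors; $[\zeta]^{\alpha}$ denotes $[\zeta]$ if $\alpha=0$ and $[\zeta]'$ if $\alpha=1$. The semantics $|\cdot|:wAC(P)\to wAI(P)$ is: $|[p]|=|[p]'|=p$ for $p\in P\cup\{0,1\}$; $|[\zeta]|=|[\zeta]'|=|\zeta|$; $|\zeta_1\oplus\zeta_2|=|\zeta_1|\oplus|\zeta_2|$; $|[\zeta_1]\otimes\cdots\otimes[\zeta_n]|=|\zeta_1|\otimes\cdots\otimes|\zeta_n|$; and if at least one $\alpha_i=1$, $|[\zeta_1]^{\alpha_1}\otimes\cdots\otimes[\zeta_n]^{\alpha_n}|=\bigoplus_{i:\alpha_i=1}\big(|\zeta_i|\otimes\bigotimes_{k\ne i,\alpha_k=1}(1\oplus|\zeta_k|)\otimes\bigotimes_{j:\alpha_j=0}(1\oplus|\zeta_j|)\big)$.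 Two connectors are equivalent, $\zeta_1\equiv\zeta_2$, iff $|\zeta_1|\equiv|\zeta_2|$ in $wAI(P)$. $\overline{\zeta}$ is the class of $\zeta$ in $wAC(P)/\equiv$, with $\overline{\zeta_1}\oplus\overline{\zeta_2}=\overline{\zeta_1\oplus\zeta_2}$ and $\overline{[\zeta_1]^\alpha}\otimes\overline{[\zeta_2]^\beta}=\overline{[\zeta_1]^\alpha\otimes[\zeta_2]^\beta}$ (well defined). -}

module Defs where

open import Level using (Level)
open import Data.Bool using (Bool; true; false; if_then_else_; _∨_)
open import Data.Nat using (ℕ; zero; suc)
open import Data.Fin using (Fin)
open import Data.Vec using (Vec; []; _∷_; lookup)
open import Data.Vec.Properties using (≡-dec)
import Data.Bool.Properties as BoolP
open import Data.List using (List; []; _∷_; map; foldr; foldl; concatMap)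
open import Data.Product using (_×_; _,_; proj₁; proj₂)
open import Relation.Nullary.Decidable using (⌊_⌋; Dec)
open import Relation.Binary.PropositionalEquality using (_≡_)
open import Algebra.Bundles using (CommutativeSemiring)
open import Data.Fin.Subset using (Subset; _∪_) renaming (⊥ to ∅)

-- Ports: P = Fin n.  The constants 0 and 1 are separate constructors,
-- so 0,1 ∉ P automatically.

-- Syntax of wAI(P).  (Parentheses (z) are purely notational: ‖(z)‖ = ‖z‖,
-- so they are represented by the tree structure itself.)
data Term (n : ℕ) : Set where
  t0 t1 : Term n
  port  : Fin n → Term n
  _⊕_   : Term n → Term n → Term n
  _⊗_   : Term n → Term n → Term n

data Atom (n : ℕ) : Set where
  a0 a1 : Atom n
  aport : Fin n → Atom n

atomTerm : ∀ {n} → Atom n → Term n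
atomTerm a0 = t0
atomTerm a1 = t1
atomTerm (aport p) = port p

-- Syntax of wAC(P).  The type bit α : Bool is  false = synchron ([_]),
-- true = trigger ([_]').
mutual
  data Typed (n : ℕ) : Set where
    atm : Atom n → Bool → Typed n
    brk : Conn n → Bool → Typed n

  data Conn (n : ℕ) : Set where
    typed : Typed n → Conn n
    _⊕c_  : Conn n → Conn n → Conn n
    -- weighted fusion [ζ₁]^α₁ ⊗ [ζ₂]^α₂ ⊗ ⋯ ⊗ [ζₘ]^αₘ of m ≥ 2 typed connectors
    fuse  : Typed n → Typed n → List (Typed n) → Conn n

[_]^_ : ∀ {n} → Conn n → Bool → Conn n
[ ζ ]^ α = typed (brk ζ α)

select : ∀ {A : Set} → List A → List (A × List A)
select [] = []
select (x ∷ xs) = (x , xs) ∷ map (λ { (y , ys) → (y , x ∷ ys) }) (select xs)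

fusionSem : ∀ {n} → (Bool × Term n) → List (Bool × Term n) → Term n
fusionSem {n} h rest with trigTerms (select (h ∷ rest))
  where
  trigTerms : List ((Bool × Term n) × List (Bool × Term n)) → List (Term n)
  trigTerms [] = []
  trigTerms (((true , z) , others) ∷ r) =
    foldl (λ acc bt → acc ⊗ (t1 ⊕ proj₂ bt)) z others ∷ trigTerms r
  trigTerms (((false , _) , _) ∷ r) = trigTerms r
... | []     = foldl (λ acc bt → acc ⊗ proj₂ bt) (proj₂ h) rest   -- all synchrons
... | x ∷ xs = foldl _⊕_ x xs                                      -- some trigger

mutual
  ∣_∣ : ∀ {n} → Conn n → Term n
  ∣ typed t ∣ = ∣ t ∣T
  ∣ ζ₁ ⊕c ζ₂ ∣ = ∣ ζ₁ ∣ ⊕ ∣ ζ₂ ∣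
  ∣ fuse t₁ t₂ ts ∣ = fusionSem (semT t₁) (semT t₂ ∷ semTs ts)

  ∣_∣T : ∀ {n} → Typed n → Term n
  ∣ atm p _ ∣T = atomTerm p
  ∣ brk ζ _ ∣T = ∣ ζ ∣

  semT : ∀ {n} → Typed n → Bool × Term n
  semT (atm p α) = α , atomTerm p
  semT (brk ζ α) = α , ∣ ζ ∣

  semTs : ∀ {n} → List (Typed n) → List (Bool × Term n)
  semTs [] = []
  semTs (t ∷ ts) = semT t ∷ semTs ts

-- Semantics of wAI(P) over K, with Γ(P) = 2^(2^P) represented by
-- characteristic functions γ : Subset n → Bool.

allSubsets : (n : ℕ) → List (Subset n)
allSubsets zero = [] ∷ []
allSubsets (suc n) = concatMap (λ s → (true ∷ s) ∷ (false ∷ s) ∷ []) (allSubsets n)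

Γ : ℕ → Set
Γ n = Subset n → Bool

_≟s_ : ∀ {n} (a b : Subset n) → Dec (a ≡ b)
_≟s_ = ≡-dec BoolP._≟_

singleton : ∀ {n} → Subset n → Γ n
singleton a b = ⌊ b ≟s a ⌋

module WAI {c ℓ : Level} (K : CommutativeSemiring c ℓ) (n : ℕ)
           (k : Fin n → CommutativeSemiring.Carrier K) where
  open CommutativeSemiring K

  sumOver : Γ n → (Subset n → Carrier) → Carrier
  sumOver γ f = foldr (λ a acc → if γ a then f a + acc else acc) 0# (allSubsets n)

  sumSplit : Subset n → (Subset n → Subset n → Carrier) → Carrier
  sumSplit a f = foldr (λ a₁ acc → foldr (λ a₂ acc' →
                   if ⌊ (a₁ ∪ a₂) ≟s a ⌋ then f a₁ a₂ + acc' else acc')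
                   acc (allSubsets n)) 0# (allSubsets n)

  anyIn : Γ n → (Subset n → Bool) → Bool
  anyIn γ P = foldr (λ a acc → (γ a Data.Bool.∧ P a) ∨ acc) false (allSubsets n)

  ‖_‖ : Term n → Γ n → Carrier
  ‖ t0 ‖ γ = 0#
  ‖ t1 ‖ γ = if γ ∅ then 1# else 0#
  ‖ port p ‖ γ = if anyIn γ (λ a → lookup a p) then k p else 0#
  ‖ z₁ ⊕ z₂ ‖ γ = sumOver γ (λ a → ‖ z₁ ‖ (singleton a) + ‖ z₂ ‖ (singleton a))
  ‖ z₁ ⊗ z₂ ‖ γ = sumOver γ (λ a → sumSplit a (λ a₁ a₂ →
                     ‖ z₁ ‖ (singleton a₁) * ‖ z₂ ‖ (singleton a₂)))

  _≡I_ : Term n → Term n → Set ℓ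
  z₁ ≡I z₂ = ∀ (γ : Γ n) → ‖ z₁ ‖ γ ≈ ‖ z₂ ‖ γ

  -- equivalence on wAC(P): ζ₁ ≡ ζ₂ iff |ζ₁| ≡ |ζ₂|; equality of classes
  -- in wAC(P)/≡ is exactly this relation.
  _≡C_ : Conn n → Conn n → Set ℓ
  ζ₁ ≡C ζ₂ = ∣ ζ₁ ∣ ≡I ∣ ζ₂ ∣

{-# OPTIONS --safe #-}
-- The semantics forgets the brackets: |[ζ]^α| = |ζ|, so (a) and (b) hold
-- by computation.  (c) is commutativity of ⊕ in wAI(P), and so is (d) when
-- both connectors are triggers; with exactly one trigger both fusions denote
-- the same term, and with two synchrons (d) is commutativity of ⊗ in wAI(P).
-- The latter comes from the symmetry a₁ ∪ a₂ = a₂ ∪ a₁ of the splittings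
-- a₁ ∪ a₂ = a, after exchanging the two sums over subsets.
module Submission where

open import Defs
open import Level using (Level)
open import Data.Nat using (ℕ; suc)
open import Data.Fin using (Fin)
open import Data.Bool using (Bool; true; false; if_then_else_)
open import Data.Product using (_×_; _,_)
open import Data.List using ([]; _∷_; List; foldr)
open import Algebra.Bundles using (CommutativeMonoid; CommutativeSemiring)
open import Data.Fin.Subset using (Subset; _∪_)
open import Data.Fin.Subset.Properties using (∪-comm)
open import Relation.Nullary.Decidable using (⌊_⌋)
open import Relation.Binary.PropositionalEquality using (subst)
import Algebra.Properties.CommutativeSemigroup as CommutativeSemigroupProperties
import Relation.Binary.Reasoning.Setoid as SetoidReasoning

module ListSum {c ℓ : Level} (M : CommutativeMonoid c ℓ) where
  open CommutativeMonoid M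
  open CommutativeSemigroupProperties commutativeSemigroup using (interchange)

  ∑ : {A : Set} → List A → (A → Carrier) → Carrier
  ∑ xs f = foldr (λ x acc → f x ∙ acc) ε xs

  ∑-cong : {A : Set} (xs : List A) {f g : A → Carrier} →
           (∀ x → f x ≈ g x) → ∑ xs f ≈ ∑ xs g
  ∑-cong []       f≈g = refl
  ∑-cong (x ∷ xs) f≈g = ∙-cong (f≈g x) (∑-cong xs f≈g)

  ∑-ε : {A : Set} (xs : List A) → ∑ xs (λ _ → ε) ≈ ε
  ∑-ε []       = refl
  ∑-ε (x ∷ xs) = trans (identityˡ _) (∑-ε xs)

  ∑-distrib : {A : Set} (xs : List A) (f g : A → Carrier) →
              ∑ xs f ∙ ∑ xs g ≈ ∑ xs (λ x → f x ∙ g x)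
  ∑-distrib []       f g = identityˡ ε
  ∑-distrib (x ∷ xs) f g = trans (interchange _ _ _ _) (∙-congˡ (∑-distrib xs f g))

  ∑-comm : {A B : Set} (xs : List A) (ys : List B) (h : A → B → Carrier) →
           ∑ xs (λ x → ∑ ys (h x)) ≈ ∑ ys (λ y → ∑ xs (λ x → h x y))
  ∑-comm []       ys h = sym (∑-ε ys)
  ∑-comm (x ∷ xs) ys h = trans (∙-congˡ (∑-comm xs ys h)) (∑-distrib ys (h x) _)

  if-then-ε-cong : (b : Bool) {u v : Carrier} → u ≈ v →
                   (if b then u else ε) ≈ (if b then v else ε)
  if-then-ε-cong true  u≈v = u≈v
  if-then-ε-cong false u≈v = refl

  foldr-if≈∑ : {A : Set} (xs : List A) (b : A → Bool) (f : A → Carrier) (acc : Carrier) →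
               foldr (λ x acc′ → if b x then f x ∙ acc′ else acc′) acc xs
                 ≈ ∑ xs (λ x → if b x then f x else ε) ∙ acc
  foldr-if≈∑ []       b f acc = sym (identityˡ acc)
  foldr-if≈∑ (x ∷ xs) b f acc with b x
  ... | true  = trans (∙-congˡ (foldr-if≈∑ xs b f acc)) (sym (assoc _ _ _))
  ... | false = trans (foldr-if≈∑ xs b f acc) (∙-congʳ (sym (identityˡ _)))

module InteractionCommutativity {c ℓ : Level} (K : CommutativeSemiring c ℓ) (n : ℕ)
                                (k : Fin n → CommutativeSemiring.Carrier K) where
  open CommutativeSemiring K
  open WAI K n k
  open ListSum +-commutativeMonoid
  open SetoidReasoning setoid

  sumOver-cong : ∀ γ {f g : Subset n → Carrier} → (∀ a → f a ≈ g a) →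
                 sumOver γ f ≈ sumOver γ g
  sumOver-cong γ {f} {g} f≈g = go (allSubsets n)
    where
    go : ∀ as → foldr (λ a acc → if γ a then f a + acc else acc) 0# as
              ≈ foldr (λ a acc → if γ a then g a + acc else acc) 0# as
    go []       = refl
    go (a ∷ as) with γ a
    ... | true  = +-cong (f≈g a) (go as)
    ... | false = go as

  sumSplit≈∑∑ : ∀ a f → sumSplit a f ≈
    ∑ (allSubsets n) (λ a₁ → ∑ (allSubsets n) (λ a₂ →
      if ⌊ (a₁ ∪ a₂) ≟s a ⌋ then f a₁ a₂ else 0#))
  sumSplit≈∑∑ a f = go (allSubsets n)
    where
    go : ∀ as → foldr (λ a₁ acc → foldr (λ a₂ acc′ →
                  if ⌊ (a₁ ∪ a₂) ≟s a ⌋ then f a₁ a₂ + acc′ else acc′)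
                  acc (allSubsets n)) 0# as
              ≈ ∑ as (λ a₁ → ∑ (allSubsets n) (λ a₂ →
                  if ⌊ (a₁ ∪ a₂) ≟s a ⌋ then f a₁ a₂ else 0#))
    go []        = refl
    go (a₁ ∷ as) = trans (foldr-if≈∑ (allSubsets n) (λ a₂ → ⌊ (a₁ ∪ a₂) ≟s a ⌋) (f a₁) _)
                         (+-congˡ (go as))

  sumSplit-swap : ∀ a (f g : Subset n → Subset n → Carrier) →
                  (∀ a₁ a₂ → f a₁ a₂ ≈ g a₂ a₁) → sumSplit a f ≈ sumSplit a g
  sumSplit-swap a f g f≈g = begin
    sumSplit a f
      ≈⟨ sumSplit≈∑∑ a f ⟩
    ∑ (allSubsets n) (λ a₁ → ∑ (allSubsets n) (λ a₂ → if ⌊ (a₁ ∪ a₂) ≟s a ⌋ then f a₁ a₂ else 0#))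
      ≈⟨ ∑-comm (allSubsets n) (allSubsets n) _ ⟩
    ∑ (allSubsets n) (λ a₂ → ∑ (allSubsets n) (λ a₁ → if ⌊ (a₁ ∪ a₂) ≟s a ⌋ then f a₁ a₂ else 0#))
      ≈⟨ ∑-cong (allSubsets n) (λ a₂ → ∑-cong (allSubsets n) (λ a₁ → swapped a₁ a₂)) ⟩
    ∑ (allSubsets n) (λ a₂ → ∑ (allSubsets n) (λ a₁ → if ⌊ (a₂ ∪ a₁) ≟s a ⌋ then g a₂ a₁ else 0#))
      ≈⟨ sym (sumSplit≈∑∑ a g) ⟩
    sumSplit a g ∎
    where
    swapped : ∀ a₁ a₂ → (if ⌊ (a₁ ∪ a₂) ≟s a ⌋ then f a₁ a₂ else 0#)
                      ≈ (if ⌊ (a₂ ∪ a₁) ≟s a ⌋ then g a₂ a₁ else 0#)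
    swapped a₁ a₂ = subst (λ s → (if ⌊ (a₁ ∪ a₂) ≟s a ⌋ then f a₁ a₂ else 0#)
                                 ≈ (if ⌊ s ≟s a ⌋ then g a₂ a₁ else 0#))
                          (∪-comm a₁ a₂)
                          (if-then-ε-cong ⌊ (a₁ ∪ a₂) ≟s a ⌋ (f≈g a₁ a₂))

  ⊕-comm : ∀ z₁ z₂ → (z₁ ⊕ z₂) ≡I (z₂ ⊕ z₁)
  ⊕-comm z₁ z₂ γ = sumOver-cong γ (λ a → +-comm _ _)

  ⊗-comm : ∀ z₁ z₂ → (z₁ ⊗ z₂) ≡I (z₂ ⊗ z₁)
  ⊗-comm z₁ z₂ γ = sumOver-cong γ (λ a → sumSplit-swap a _ _ (λ a₁ a₂ → *-comm _ _))

proposition4 : ∀ {c ℓ : Level} (K : CommutativeSemiring c ℓ) →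
    (∀ x → CommutativeSemiring._≈_ K (CommutativeSemiring._+_ K x x) x) →
    (n : ℕ) (k : Fin (suc n) → CommutativeSemiring.Carrier K) →
    (ζ₁ ζ₂ : Conn (suc n)) (α β : Bool) →
    (WAI._≡C_ K (suc n) k ([ [ ζ₁ ]^ α ]^ β) ([ ζ₁ ]^ β))
    × (WAI._≡C_ K (suc n) k ([ ζ₁ ⊕c ζ₂ ]^ α) (([ ζ₁ ]^ α) ⊕c ([ ζ₂ ]^ α)))
    × (WAI._≡C_ K (suc n) k (([ ζ₁ ]^ α) ⊕c ([ ζ₂ ]^ β)) (([ ζ₂ ]^ β) ⊕c ([ ζ₁ ]^ α)))
    × (WAI._≡C_ K (suc n) k (fuse (brk ζ₁ α) (brk ζ₂ β) []) (fuse (brk ζ₂ β) (brk ζ₁ α) []))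
proposition4 K _ n k ζ₁ ζ₂ α β =
  (λ _ → refl) , (λ _ → refl) , ⊕-comm ∣ ζ₁ ∣ ∣ ζ₂ ∣ , fusion-comm α β
  where
  open CommutativeSemiring K using (refl)
  open WAI K (suc n) k
  open InteractionCommutativity K (suc n) k

  fusion-comm : ∀ α β → fuse (brk ζ₁ α) (brk ζ₂ β) [] ≡C fuse (brk ζ₂ β) (brk ζ₁ α) []
  fusion-comm false false = ⊗-comm ∣ ζ₁ ∣ ∣ ζ₂ ∣
  fusion-comm false true  = λ _ → refl
  fusion-comm true  false = λ _ → refl
  fusion-comm true  true  = ⊕-comm (∣ ζ₁ ∣ ⊗ (t1 ⊕ ∣ ζ₂ ∣)) (∣ ζ₂ ∣ ⊗ (t1 ⊕ ∣ ζ₁ ∣))
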